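{- Let $A$ be an admissible set of addition chains. Then: (1) For all integers $a\ge1$, $\delta^A(a)\ge 0$, with equality if and only if $a=2^k$ for some integer $k\ge0$. (2) For all integers $n\ge1$ and $k\ge0$, $\delta^A(2^k n)\le\delta^A(n)$; the difference $\delta^A(n)-\delta^A(2^kn)$ is an integer, and equality holds if and only if $\ell^A(2^k n)=\ell^A(n)+k$.
   Context: An addition chain for a positive integer $n$ is a sequence $(a_0,\ldots,a_r)$ with $a_0=1$, $a_r=n$, and for every $1\le k\le r$ there exist $0\le i,j<k$ with $a_k=a_i+a_j$; $r$ is its length. For a set $A$ of addition chains, $\ell^A(n)$ is the least length of an addition chain for $n$ belonging to $A$. $\nu_2(n)$ is the number of $1$'s in the binary expansion of $n$. $A$ is admissible if (i) for every $n\ge1$, $\ell^A(n)$ is defined and $\ell^A(n)\le\lfloor\log_2 n\rfloor+\nu_2(n)-1$, and (ii) for every $n\ge1$, $\ell^A(2n)\le\ell^A(n)+1$. The $A$-defect is $\delta^A(n)=\ell^A(n)-\log_2 n$. -}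

module Defs where

open import Data.Nat using (ℕ; zero; suc; _+_; _*_; _∸_; _^_; _≤_; _<_)
open import Data.Nat.DivMod using (_/_; _%_)
open import Data.Nat.Logarithm using (⌊log₂_⌋)
open import Data.Integer using (ℤ; +_; -[1+_])
open import Data.Fin using (Fin; toℕ; fromℕ)
open import Data.Product using (Σ; ∃; _×_)
open import Relation.Binary.PropositionalEquality using (_≡_)

record AdditionChain : Set where
  field
    len   : ℕ
    elem  : Fin (suc len) → ℕ
    first : elem Fin.zero ≡ 1
    step  : (k : Fin (suc len)) → 0 < toℕ k →
            Σ (Fin (suc len)) λ i → Σ (Fin (suc len)) λ j →
              toℕ i < toℕ k × toℕ j < toℕ k × elem k ≡ elem i + elem j

open AdditionChain public

target : AdditionChain → ℕ
target c = elem c (fromℕ (len c))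

ChainSet : Set₁
ChainSet = AdditionChain → Set

IsLA : ChainSet → ℕ → ℕ → Set
IsLA A n l =
  (Σ AdditionChain λ c → A c × target c ≡ n × len c ≡ l) ×
  ((c : AdditionChain) → A c → target c ≡ n → l ≤ len c)

-- number of 1's in binary expansion (fuel-based; fuel n suffices for n)
ν₂-fuel : ℕ → ℕ → ℕ
ν₂-fuel zero    m = 0
ν₂-fuel (suc f) m = m % 2 + ν₂-fuel f (m / 2)

ν₂ : ℕ → ℕ
ν₂ n = ν₂-fuel n n

Admissible : ChainSet → Set
Admissible A =
  ((n : ℕ) → 1 ≤ n → Σ ℕ λ l → IsLA A n l × l ≤ ⌊log₂ n ⌋ + ν₂ n ∸ 1) ×
  ((n l l′ : ℕ) → 1 ≤ n → IsLA A n l → IsLA A (2 * n) l′ → l′ ≤ l + 1)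

-- Defects are real numbers of the form l - log₂ m (m ≥ 1); we encode them
-- exactly via the pair (l , m) and express comparisons multiplicatively.
-- (l - log₂ m) ≤ (l′ - log₂ m′)  ⟺  2^l * m′ ≤ 2^l′ * m
DefectLe : ℕ → ℕ → ℕ → ℕ → Set
DefectLe l m l′ m′ = 2 ^ l * m′ ≤ 2 ^ l′ * m

-- (l - log₂ m) = (l′ - log₂ m′)
DefectEq : ℕ → ℕ → ℕ → ℕ → Set
DefectEq l m l′ m′ = 2 ^ l * m′ ≡ 2 ^ l′ * m

-- (l - log₂ m) - (l′ - log₂ m′) = d   (d an integer)
DefectDiff : ℕ → ℕ → ℕ → ℕ → ℤ → Set
DefectDiff l m l′ m′ (+ j)     = 2 ^ l * m′ ≡ 2 ^ j * (2 ^ l′ * m)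
DefectDiff l m l′ m′ -[1+ j ]  = 2 ^ suc j * (2 ^ l * m′) ≡ 2 ^ l′ * m

{-# OPTIONS --safe #-}
module Submission where

-- The i-th entry of an addition chain is at most 2^i, so n ≤ 2^ℓ(n): the
-- defect is nonnegative.  Iterating admissibility (ii) gives
-- ℓ(2^k n) ≤ ℓ(n) + k, which is the monotonicity of the defect under doubling;
-- since admissibility (i) forces ℓ(1) = 0, it also gives ℓ(2^k) = k, so powers
-- of two have defect zero.

open import Defs
open import Data.Nat using (ℕ; zero; suc; _+_; _*_; _∸_; _^_; _≤_; _<_; z≤n; s≤s; z<s; NonZero; >-nonZero)
open import Data.Nat.Properties
open import Data.Nat.Logarithm using (⌊log₂_⌋; ⌊log₂⌋-mono-≤; ⌊log₂[2^n]⌋≡n)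
open import Induction.WellFounded using (Acc; acc)
open import Data.Integer using (ℤ; +_)
open import Data.Fin using (Fin; toℕ; fromℕ) renaming (_<_ to _<ᶠ_)
open import Data.Fin.Properties using (toℕ-fromℕ)
open import Data.Fin.Induction using (<-wellFounded)
open import Data.Product using (Σ; _×_; _,_; proj₁; proj₂)
open import Function.Bundles using (_⇔_; mk⇔)
open import Function.Construct.Composition using (_⇔-∘_)
open import Relation.Binary.PropositionalEquality

private
  variable
    a b k l l′ l₁ l₂ n : ℕ

2^-cancel-≤ : 2 ^ a ≤ 2 ^ b → a ≤ b
2^-cancel-≤ {a} {b} le = subst₂ _≤_ (⌊log₂[2^n]⌋≡n a) (⌊log₂[2^n]⌋≡n b) (⌊log₂⌋-mono-≤ le)

2^-injective : 2 ^ a ≡ 2 ^ b → a ≡ b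
2^-injective {a} {b} eq = trans (sym (⌊log₂[2^n]⌋≡n a)) (trans (cong ⌊log₂_⌋ eq) (⌊log₂[2^n]⌋≡n b))

m^a*[m^b*n]≡m^[a+b]*n : ∀ m a b n → m ^ a * (m ^ b * n) ≡ m ^ (a + b) * n
m^a*[m^b*n]≡m^[a+b]*n m a b n = begin
  m ^ a * (m ^ b * n)  ≡⟨ *-assoc (m ^ a) (m ^ b) n ⟨
  m ^ a * m ^ b * n    ≡⟨ cong (_* n) (^-distribˡ-+-* m a b) ⟨
  m ^ (a + b) * n      ∎
  where open ≡-Reasoning

elem≤2^index : (c : AdditionChain) (i : Fin (suc (len c))) → elem c i ≤ 2 ^ toℕ i
elem≤2^index c i = bound i (<-wellFounded i)
  where
  open ≤-Reasoning
  bound : ∀ i → Acc _<ᶠ_ i → elem c i ≤ 2 ^ toℕ i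
  bound Fin.zero _ = ≤-reflexive (first c)
  bound i@(Fin.suc i′) (acc rec) with step c i z<s
  ... | j , j′ , j<i , j′<i , eq = begin
    elem c i                          ≡⟨ eq ⟩
    elem c j + elem c j′              ≤⟨ +-mono-≤ (earlier j<i) (earlier j′<i) ⟩
    2 ^ toℕ i′ + 2 ^ toℕ i′           ≡⟨ cong (λ x → 2 ^ toℕ i′ + x) (+-identityʳ _) ⟨
    2 ^ toℕ i                         ∎
    where
    earlier : ∀ {j} → toℕ j < toℕ i → elem c j ≤ 2 ^ toℕ i′
    earlier j<i = ≤-trans (bound _ (rec j<i)) (^-monoʳ-≤ 2 (≤-pred j<i))

target≤2^len : (c : AdditionChain) → target c ≤ 2 ^ len c
target≤2^len c = subst (λ r → target c ≤ 2 ^ r) (toℕ-fromℕ (len c)) (elem≤2^index c (fromℕ (len c)))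

defectLe-zero : n ≤ 2 ^ l → DefectLe 0 1 l n
defectLe-zero {n} = subst₂ _≤_ (sym (*-identityˡ n)) (sym (*-identityʳ _))

defectEq-zero⇔ : DefectEq l n 0 1 ⇔ n ≡ 2 ^ l
defectEq-zero⇔ {l} {n} = mk⇔
  (λ eq → sym (subst₂ _≡_ (*-identityʳ (2 ^ l)) (*-identityˡ n) eq))
  (λ eq → subst₂ _≡_ (sym (*-identityʳ (2 ^ l))) (sym (*-identityˡ n)) (sym eq))

defectLe-scale : ∀ l₁ k → l₂ ≤ l₁ + k → DefectLe l₂ (2 ^ k * n) l₁ n
defectLe-scale {l₂} {n} l₁ k l₂≤l₁+k = begin
  2 ^ l₂ * n          ≤⟨ *-monoˡ-≤ n (^-monoʳ-≤ 2 l₂≤l₁+k) ⟩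
  2 ^ (l₁ + k) * n    ≡⟨ m^a*[m^b*n]≡m^[a+b]*n 2 l₁ k n ⟨
  2 ^ l₁ * (2 ^ k * n) ∎
  where open ≤-Reasoning

defectDiff-scale : ∀ l₁ k → l₂ ≤ l₁ + k → DefectDiff l₁ n l₂ (2 ^ k * n) (+ (l₁ + k ∸ l₂))
defectDiff-scale {l₂} {n} l₁ k l₂≤l₁+k = begin
  2 ^ l₁ * (2 ^ k * n)                 ≡⟨ m^a*[m^b*n]≡m^[a+b]*n 2 l₁ k n ⟩
  2 ^ (l₁ + k) * n                     ≡⟨ cong (λ e → 2 ^ e * n) (m∸n+n≡m l₂≤l₁+k) ⟨
  2 ^ (l₁ + k ∸ l₂ + l₂) * n           ≡⟨ m^a*[m^b*n]≡m^[a+b]*n 2 (l₁ + k ∸ l₂) l₂ n ⟨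
  2 ^ (l₁ + k ∸ l₂) * (2 ^ l₂ * n)     ∎
  where open ≡-Reasoning

defectEq-scale⇔ : ∀ l₁ k .{{_ : NonZero n}} → DefectEq l₂ (2 ^ k * n) l₁ n ⇔ l₂ ≡ l₁ + k
defectEq-scale⇔ {n} {l₂} l₁ k = mk⇔
  (λ eq → 2^-injective (*-cancelʳ-≡ (2 ^ l₂) (2 ^ (l₁ + k)) n (trans eq (m^a*[m^b*n]≡m^[a+b]*n 2 l₁ k n))))
  (λ { refl → sym (m^a*[m^b*n]≡m^[a+b]*n 2 l₁ k n) })

module _ {A : ChainSet} where

  isLA-unique : IsLA A n l → IsLA A n l′ → l ≡ l′
  isLA-unique ((c , Ac , refl , refl) , minimal) ((c′ , Ac′ , tc′ , refl) , minimal′) =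
    ≤-antisym (minimal c′ Ac′ tc′) (minimal′ c Ac refl)

  isLA⇒≤2^ : IsLA A n l → n ≤ 2 ^ l
  isLA⇒≤2^ ((c , _ , refl , refl) , _) = target≤2^len c

module _ {A : ChainSet} (adm : Admissible A) where

  -- Admissibility (i) at n = 1: the bound ⌊log₂ 1⌋ + ν₂ 1 ∸ 1 computes to 0.
  isLA-one : IsLA A 1 0
  isLA-one with adm .proj₁ 1 (s≤s z≤n)
  ... | l , ℓ1 , l≤0 = subst (IsLA A 1) (n≤0⇒n≡0 l≤0) ℓ1

  isLA-*2^-≤ : 1 ≤ n → IsLA A n l₁ → IsLA A (2 ^ k * n) l₂ → l₂ ≤ l₁ + k
  isLA-*2^-≤ {n} {l₁} {zero} {l₂} _ ℓn ℓ1*n =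
    ≤-trans (≤-reflexive (isLA-unique (subst (λ m → IsLA A m l₂) (*-identityˡ n) ℓ1*n) ℓn)) (m≤m+n l₁ 0)
  isLA-*2^-≤ {n} {l₁} {suc k} {l₂} 1≤n ℓn ℓ2ᵏ⁺¹n =
    let l′ , ℓ2ᵏn , _ = adm .proj₁ (2 ^ k * n) 1≤2ᵏn in begin
    l₂              ≤⟨ adm .proj₂ (2 ^ k * n) l′ l₂ 1≤2ᵏn ℓ2ᵏn ℓ2[2ᵏn] ⟩
    l′ + 1          ≤⟨ +-monoˡ-≤ 1 (isLA-*2^-≤ 1≤n ℓn ℓ2ᵏn) ⟩
    l₁ + k + 1      ≡⟨ +-comm (l₁ + k) 1 ⟩
    suc (l₁ + k)    ≡⟨ +-suc l₁ k ⟨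
    l₁ + suc k      ∎
    where
    open ≤-Reasoning
    1≤2ᵏn : 1 ≤ 2 ^ k * n
    1≤2ᵏn = *-mono-≤ (m^n>0 2 k) 1≤n
    ℓ2[2ᵏn] : IsLA A (2 * (2 ^ k * n)) l₂
    ℓ2[2ᵏn] = subst (λ m → IsLA A m l₂) (*-assoc 2 (2 ^ k) n) ℓ2ᵏ⁺¹n

  isLA-2^⇒≡ : IsLA A (2 ^ k) l → l ≡ k
  isLA-2^⇒≡ {k} {l} ℓ2ᵏ = ≤-antisym l≤k (2^-cancel-≤ (isLA⇒≤2^ ℓ2ᵏ))
    where
    l≤k : l ≤ k
    l≤k = isLA-*2^-≤ (s≤s z≤n) isLA-one (subst (λ m → IsLA A m l) (sym (*-identityʳ (2 ^ k))) ℓ2ᵏ)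

  defectEq-zero⇔power-of-2 : IsLA A n l → DefectEq l n 0 1 ⇔ (Σ ℕ λ k → n ≡ 2 ^ k)
  defectEq-zero⇔power-of-2 {l = l} ℓn =
    mk⇔ (l ,_) (λ { (k , refl) → cong (2 ^_) (sym (isLA-2^⇒≡ {k} ℓn)) }) ⇔-∘ defectEq-zero⇔ {l}

proposition3p1 : (A : ChainSet) → Admissible A →
    ((a l : ℕ) → 1 ≤ a → IsLA A a l →
      DefectLe 0 1 l a × (DefectEq l a 0 1 ⇔ (Σ ℕ λ k → a ≡ 2 ^ k)))
    ×
    ((n k l₁ l₂ : ℕ) → 1 ≤ n → IsLA A n l₁ → IsLA A (2 ^ k * n) l₂ →
      DefectLe l₂ (2 ^ k * n) l₁ n
      × (Σ ℤ λ d → DefectDiff l₁ n l₂ (2 ^ k * n) d)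
      × (DefectEq l₂ (2 ^ k * n) l₁ n ⇔ l₂ ≡ l₁ + k))
proposition3p1 A adm =
    (λ a l _ ℓa → defectLe-zero {l = l} (isLA⇒≤2^ ℓa) , defectEq-zero⇔power-of-2 adm ℓa)
  , (λ n k l₁ l₂ 1≤n ℓn ℓ2ᵏn →
      let l₂≤l₁+k = isLA-*2^-≤ adm 1≤n ℓn ℓ2ᵏn in
        defectLe-scale l₁ k l₂≤l₁+k
      , (+ (l₁ + k ∸ l₂) , defectDiff-scale l₁ k l₂≤l₁+k)
      , defectEq-scale⇔ l₁ k {{>-nonZero 1≤n}})
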